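{- Let $A=\{a_1,\ldots,a_n\}$ be a finite alphabet, $A^*$ the set of finite strings over $A$, $\varepsilon$ the empty string, ${}^\frown$ concatenation, and for a fixed letter $a_k\in A$ let $|\cdot|:A^*\to\{a_k\}^*$ be the tally-length function replacing every letter by $a_k$. Then the structure $(A^*,\varepsilon,a_1,\ldots,a_n,{}^\frown,|\cdot|)$ is $\exists$-interpretable in $\mathcal{T}(\mathcal{L}_{\mathsf{BT}})$.
   Context: Let $\mathbf{H}$ be the set of variable-free terms built from a constant $\perp$ and a binary function symbol $\langle\cdot,\cdot\rangle$. The substitution $t[r\mapsto s]$ is the term obtained by replacing each occurrence of $r$ in $t$ by $s$ (formally: $s$ if $t=r$; $\perp$ if $t\ne r$, $t=\perp$; $\langle t_1[r\mapsto s],t_2[r\mapsto s]\rangle$ if $t\ne r$, $t=\langle t_1,t_2\rangle$). $\mathcal{T}(\mathcal{L}_{\mathsf{BT}})=(\mathbf{H},\perp,\langle\cdot,\cdot\rangle,\cdot[\cdot\mapsto\cdot])$ (term algebra plus substitution). An existential formula is one built from atomic formulas and their negations using $\wedge,\vee$ and unbounded $\exists$. A structure $\mathfrak A$ in a finite language $\mathcal{L}_0$ is $\exists$-interpretable in a structure $\mathfrak B$ in a finite language $\mathcal{L}_1$ if there are parameter-free existential $\mathcal{L}_1$-formulas: $\delta(x)$ defining a nonempty subset $A'$ of the universe of $\mathfrak B$; for each constant $c$ of $\mathcal{L}_0$ a formula $\phi_c(x)$ defining a unique element of $A'$; for each $n$-ary function symbol $f$ a formula $\phi_f(x_1,\ldots,x_n,y)$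 defining a function $(A')^n\to A'$; for each $n$-ary relation symbol $R$ formulas $\phi_R$, $\phi_{R^c}$ defining disjoint sets whose union is $(A')^n$; such that the resulting $\mathcal{L}_0$-structure on $A'$ is isomorphic to $\mathfrak A$ (equality is interpreted as equality). -}

module Defs where

open import Data.Nat using (ℕ; zero; suc)
open import Data.Fin using (Fin)
open import Data.Vec using (Vec; []; _∷_; lookup; map)
open import Data.Vec.Relation.Unary.All using (All)
open import Data.List using (List; []; _∷_; _++_; length; replicate)
open import Data.Maybe using (Maybe; nothing; just)
open import Data.Product using (Σ; _×_; _,_; ∃)
open import Data.Sum using (_⊎_)
open import Data.Empty using (⊥)
open import Relation.Nullary using (¬_)
open import Relation.Binary.PropositionalEquality using (_≡_; _≢_)
open import Relation.Nullary.Decidable using (yes; no)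

data H : Set where
  ⊥ₕ    : H
  ⟨_,_⟩ : H → H → H

infix 4 _≟ₕ_
_≟ₕ_ : (s t : H) → Relation.Nullary.Dec (s ≡ t)
⊥ₕ ≟ₕ ⊥ₕ = yes Relation.Binary.PropositionalEquality.refl
⊥ₕ ≟ₕ ⟨ _ , _ ⟩ = no λ ()
⟨ _ , _ ⟩ ≟ₕ ⊥ₕ = no λ ()
⟨ a , b ⟩ ≟ₕ ⟨ c , d ⟩ with a ≟ₕ c | b ≟ₕ d
... | yes Relation.Binary.PropositionalEquality.refl | yes Relation.Binary.PropositionalEquality.refl = yes Relation.Binary.PropositionalEquality.refl
... | no p | _ = no λ { Relation.Binary.PropositionalEquality.refl → p Relation.Binary.PropositionalEquality.refl }
... | yes _ | no q = no λ { Relation.Binary.PropositionalEquality.refl → q Relation.Binary.PropositionalEquality.refl }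

_[_↦_] : H → H → H → H
t [ r ↦ s ] with t ≟ₕ r
... | yes _ = s
t@⊥ₕ [ r ↦ s ] | no _ = ⊥ₕ
⟨ t₁ , t₂ ⟩ [ r ↦ s ] | no _ = ⟨ t₁ [ r ↦ s ] , t₂ [ r ↦ s ] ⟩

-- There are no constants other than ⊥, so formulas are parameter-free.

data Tm (n : ℕ) : Set where
  var  : Fin n → Tm n
  bot  : Tm n
  pair : Tm n → Tm n → Tm n
  sub  : Tm n → Tm n → Tm n → Tm n

data ExFm (n : ℕ) : Set where
  _≐_  : Tm n → Tm n → ExFm n
  _≠_  : Tm n → Tm n → ExFm n
  _∧_  : ExFm n → ExFm n → ExFm n
  _∨_  : ExFm n → ExFm n → ExFm n
  ∃'   : ExFm (suc n) → ExFm n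

evalTm : ∀ {n} → Vec H n → Tm n → H
evalTm ρ (var i)     = lookup ρ i
evalTm ρ bot         = ⊥ₕ
evalTm ρ (pair t u)  = ⟨ evalTm ρ t , evalTm ρ u ⟩
evalTm ρ (sub t r s) = evalTm ρ t [ evalTm ρ r ↦ evalTm ρ s ]

-- satisfaction in T(L_BT); the bound variable of ∃' is variable 0
Sat : ∀ {n} → Vec H n → ExFm n → Set
Sat ρ (t ≐ u) = evalTm ρ t ≡ evalTm ρ u
Sat ρ (t ≠ u) = evalTm ρ t ≢ evalTm ρ u
Sat ρ (φ ∧ ψ) = Sat ρ φ × Sat ρ ψ
Sat ρ (φ ∨ ψ) = Sat ρ φ ⊎ Sat ρ ψ
Sat ρ (∃' φ)  = Σ H λ h → Sat (h ∷ ρ) φ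

record Signature : Set₁ where
  field
    Const : Set
    Fun   : ℕ → Set
    Rel   : ℕ → Set

record Structure (L : Signature) : Set₁ where
  open Signature L
  field
    Carrier : Set
    const   : Const → Carrier
    fun     : ∀ {m} → Fun m → Vec Carrier m → Carrier
    rel     : ∀ {m} → Rel m → Vec Carrier m → Set

-- Conventions: δ has one free variable; φc has one free variable;
-- φf for an m-ary f has m+1 free variables, variable 0 is the output y
-- and variables 1..m are the inputs x₁..xₘ (environment y ∷ xs).
-- The isomorphism of the induced structure on A' with 𝔄 is given by an
-- injective map ι : 𝔄 → H whose image is exactly A'.

record ∃-Interpretation {L : Signature} (𝔄 : Structure L) : Set₁ where
  open Signature L
  open Structure 𝔄
  field
    δ   : ExFm 1
    φc  : Const → ExFm 1
    φf  : ∀ {m} → Fun m → ExFm (suc m)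
    φR  : ∀ {m} → Rel m → ExFm m
    φRᶜ : ∀ {m} → Rel m → ExFm m

  InA' : H → Set
  InA' h = Sat (h ∷ []) δ

  field
    nonempty : Σ H InA'
    const-def : ∀ c → Σ H λ h → InA' h × Sat (h ∷ []) (φc c)
                  × (∀ h' → Sat (h' ∷ []) (φc c) → h' ≡ h)
    fun-dom   : ∀ {m} (f : Fun m) (xs : Vec H m) (y : H) →
                  Sat (y ∷ xs) (φf f) → All InA' xs × InA' y
    fun-total : ∀ {m} (f : Fun m) (xs : Vec H m) → All InA' xs →
                  Σ H λ y → Sat (y ∷ xs) (φf f)
    fun-func  : ∀ {m} (f : Fun m) (xs : Vec H m) (y y' : H) →
                  Sat (y ∷ xs) (φf f) → Sat (y' ∷ xs) (φf f) → y ≡ y'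
    rel-dom   : ∀ {m} (R : Rel m) (xs : Vec H m) →
                  (Sat xs (φR R) ⊎ Sat xs (φRᶜ R)) → All InA' xs
    rel-cover : ∀ {m} (R : Rel m) (xs : Vec H m) → All InA' xs →
                  Sat xs (φR R) ⊎ Sat xs (φRᶜ R)
    rel-disj  : ∀ {m} (R : Rel m) (xs : Vec H m) →
                  Sat xs (φR R) → Sat xs (φRᶜ R) → ⊥
    ι         : Carrier → H
    ι-inj     : ∀ a b → ι a ≡ ι b → a ≡ b
    ι-into    : ∀ a → InA' (ι a)
    ι-onto    : ∀ h → InA' h → Σ Carrier λ a → ι a ≡ h
    ι-const   : ∀ c → Sat (ι (const c) ∷ []) (φc c)
    ι-fun     : ∀ {m} (f : Fun m) (as : Vec Carrier m) →
                  Sat (ι (fun f as) ∷ map ι as) (φf f)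
    ι-rel     : ∀ {m} (R : Rel m) (as : Vec Carrier m) →
                  (rel R as → Sat (map ι as) (φR R))
                  × (¬ rel R as → Sat (map ι as) (φRᶜ R))

∃-Interpretable : {L : Signature} → Structure L → Set₁
∃-Interpretable 𝔄 = ∃-Interpretation 𝔄

data StrFun : ℕ → Set where
  concat : StrFun 2
  tally  : StrFun 1

StrSig : ℕ → Signature
StrSig n = record
  { Const = Maybe (Fin n)   -- nothing ↦ ε, just i ↦ the letter aᵢ
  ; Fun   = StrFun
  ; Rel   = λ _ → ⊥
  }

tallyLen : ∀ {n} → Fin n → List (Fin n) → List (Fin n)
tallyLen k w = replicate (length w) k

StrStructure : ∀ {n} → Fin n → Structure (StrSig n)
StrStructure {n} k = record
  { Carrier = List (Fin n)
  ; const   = c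
  ; fun     = f
  ; rel     = λ ()
  }
  where
  c : Maybe (Fin n) → List (Fin n)
  c nothing  = []
  c (just i) = i ∷ []
  f : ∀ {m} → StrFun m → Vec (List (Fin n)) m → List (Fin n)
  f concat (u ∷ v ∷ []) = u ++ v
  f tally  (u ∷ [])     = tallyLen k u

-- A word a_{i₁} ⋯ a_{iₘ} is coded by the right comb ⟨c_{i₁}, ⟨c_{i₂}, … ⟨c_{iₘ}, e⟩⋯⟩⟩,
-- with letter codes c_i and an end marker e that occurs in no letter code. Concatenation
-- is then u[e ↦ v] and renaming a letter is a substitution of letter codes. Replacing
-- c_{n-1}, …, c₁ by c₀ one after another collapses every code to the code of a power of
-- a₀, and the powers of a₀ are exactly the words t with t ⁀ a₀ = a₀ ⁀ t, i.e.
-- t[e ↦ ⟨c₀, e⟩] = ⟨c₀, t⟩. So "the collapse of x commutes with a₀" is a quantifier-free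
-- definition of the set of codes, and the collapse followed by c₀ ↦ c_k is the tally
-- length. That this equation holds only of codes rests on one fact about substitution:
-- if t[r ↦ s] = u and s does not occur in u, then t = u.
module Submission where

open import Defs
open import Data.Nat using (ℕ; zero; suc; _≤_; _+_; _≟_; z≤n; s≤s)
open import Data.Nat.Properties using (suc-injective; 0≢1+n; m<1+n⇒m≤n; ≤∧≢⇒<; ≤-refl; m≤m+n; m≤n+m; m≤n⇒m≤1+n; <-irrefl; ≤-trans)
open import Data.Fin using (Fin; toℕ; fromℕ<) renaming (zero to fzero; suc to fsuc)
open import Data.Fin.Properties using (toℕ≤pred[n]; toℕ-fromℕ<; toℕ-injective)
open import Data.List using (List; []; _∷_; _++_; length; replicate; map; [_])
open import Data.List.Properties using (map-++; length-map; map-replicate; map-injective)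
open import Data.List.Relation.Unary.All as All using (All; []; _∷_)
open import Data.List.Relation.Unary.All.Properties using (replicate⁺; map⁺; ++⁺)
open import Data.Vec as Vec using (Vec; []; _∷_)
open import Data.Vec.Relation.Unary.All as AllVec using ([]; _∷_)
open import Data.Product using (∃-syntax; Σ-syntax; _×_; _,_; proj₁; proj₂)
open import Data.Sum using (_⊎_; inj₁; inj₂)
open import Data.Empty using (⊥-elim)
open import Function using (_∘_)
open import Relation.Nullary using (¬_; yes; no)
open import Relation.Binary.PropositionalEquality hiding ([_])

private
  variable
    a b r s t u : H
    i j : ℕ
    es : List ℕ

infix 4 _⊑_
data _⊑_ (s : H) : H → Set where
  here : s ⊑ s
  inˡ  : s ⊑ a → s ⊑ ⟨ a , b ⟩
  inʳ  : s ⊑ b → s ⊑ ⟨ a , b ⟩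

size : H → ℕ
size ⊥ₕ        = 0
size ⟨ a , b ⟩ = suc (size a + size b)

⊑⇒size≤ : s ⊑ t → size s ≤ size t
⊑⇒size≤ here                  = ≤-refl
⊑⇒size≤ (inˡ {a = a} {b} p) = m≤n⇒m≤1+n (≤-trans (⊑⇒size≤ p) (m≤m+n (size a) (size b)))
⊑⇒size≤ (inʳ {b = b} {a} p) = m≤n⇒m≤1+n (≤-trans (⊑⇒size≤ p) (m≤n+m (size b) (size a)))

pair⋢left : ¬ ⟨ a , b ⟩ ⊑ a
pair⋢left {a} {b} p = <-irrefl refl (≤-trans (s≤s (m≤m+n (size a) (size b))) (⊑⇒size≤ p))

pair⋢right : ¬ ⟨ a , b ⟩ ⊑ b
pair⋢right {a} {b} p = <-irrefl refl (≤-trans (s≤s (m≤n+m (size b) (size a))) (⊑⇒size≤ p))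

⟨,⟩-injective : ∀ {a b c d} → ⟨ a , b ⟩ ≡ ⟨ c , d ⟩ → a ≡ c × b ≡ d
⟨,⟩-injective refl = refl , refl

[↦]-hit : t ≡ r → t [ r ↦ s ] ≡ s
[↦]-hit {t} {r} t≡r with t ≟ₕ r
... | yes _   = refl
... | no t≢r = ⊥-elim (t≢r t≡r)

[↦]-⊥ : ⊥ₕ ≢ r → ⊥ₕ [ r ↦ s ] ≡ ⊥ₕ
[↦]-⊥ {r} ⊥≢r with ⊥ₕ ≟ₕ r
... | yes ⊥≡r = ⊥-elim (⊥≢r ⊥≡r)
... | no _     = refl

[↦]-pair : ⟨ a , b ⟩ ≢ r → ⟨ a , b ⟩ [ r ↦ s ] ≡ ⟨ a [ r ↦ s ] , b [ r ↦ s ] ⟩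
[↦]-pair {a} {b} {r} ab≢r with ⟨ a , b ⟩ ≟ₕ r
... | yes ab≡r = ⊥-elim (ab≢r ab≡r)
... | no _      = refl

[↦]-fresh : ¬ r ⊑ t → t [ r ↦ s ] ≡ t
[↦]-fresh {t = ⊥ₕ}        {s = s} r⋢t = [↦]-⊥ {s = s} (λ { refl → r⋢t here })
[↦]-fresh {t = ⟨ a , b ⟩} {s = s} r⋢t =
  trans ([↦]-pair {s = s} (λ { refl → r⋢t here }))
        (cong₂ ⟨_,_⟩ ([↦]-fresh {s = s} (r⋢t ∘ inˡ)) ([↦]-fresh {s = s} (r⋢t ∘ inʳ)))

-- If s does not occur in the result, no occurrence of r was replaced.
[↦]-reflect : ¬ s ⊑ u → t [ r ↦ s ] ≡ u → t ≡ u
[↦]-reflect {s} {u} {t} {r} s⋢u eq with t ≟ₕ r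
... | yes _ = ⊥-elim (s⋢u (subst (s ⊑_) eq here))
[↦]-reflect {t = ⊥ₕ}        s⋢u eq | no _ = eq
[↦]-reflect {t = ⟨ a , b ⟩} s⋢u refl | no _ =
  cong₂ ⟨_,_⟩ ([↦]-reflect (s⋢u ∘ inˡ) refl) ([↦]-reflect (s⋢u ∘ inʳ) refl)

[↦]≡target : t [ r ↦ s ] ≡ s → t ≡ r ⊎ t ≡ s
[↦]≡target {t} {r} eq with t ≟ₕ r
... | yes t≡r = inj₁ t≡r
[↦]≡target {⊥ₕ}                  eq | no _ = inj₂ eq
[↦]≡target {⟨ a , b ⟩} {s = ⟨ _ , _ ⟩} eq | no _ with ⟨,⟩-injective eq
... | eqˡ , eqʳ = inj₂ (cong₂ ⟨_,_⟩ ([↦]-reflect pair⋢left eqˡ) ([↦]-reflect pair⋢right eqʳ))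

unary : ℕ → H
unary zero    = ⊥ₕ
unary (suc j) = ⟨ ⊥ₕ , unary j ⟩

letter : ℕ → H
letter i = ⟨ unary (suc i) , ⊥ₕ ⟩

end : H
end = ⟨ unary 1 , unary 1 ⟩

code : List ℕ → H
code []       = end
code (i ∷ es) = ⟨ letter i , code es ⟩

unary-injective : unary i ≡ unary j → i ≡ j
unary-injective {zero}  {zero}  _  = refl
unary-injective {suc i} {suc j} eq = cong suc (unary-injective (proj₂ (⟨,⟩-injective eq)))

letter-injective : letter i ≡ letter j → i ≡ j
letter-injective eq = suc-injective (unary-injective (proj₁ (⟨,⟩-injective eq)))

code-injective : ∀ es fs → code es ≡ code fs → es ≡ fs
code-injective []       []       _  = refl
code-injective (i ∷ es) (j ∷ fs) eq with ⟨,⟩-injective eq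
... | eqˡ , eqʳ = cong₂ _∷_ (letter-injective eqˡ) (code-injective es fs eqʳ)

code≢⊥ : ∀ es → code es ≢ ⊥ₕ
code≢⊥ []      ()
code≢⊥ (_ ∷ _) ()

code∷≢end : ∀ i es → code (i ∷ es) ≢ end
code∷≢end i es ()

-- Letter codes and the end marker are pairs with a pair on the left; unary codes contain none.
left-pair⋢unary : ∀ {c} j → ¬ ⟨ ⟨ a , b ⟩ , c ⟩ ⊑ unary j
left-pair⋢unary (suc j) (inʳ p) = left-pair⋢unary j p

end⋢letter : ∀ i → ¬ end ⊑ letter i
end⋢letter i (inˡ p) = left-pair⋢unary (suc i) p

letter⋢end : ∀ i → ¬ letter i ⊑ end
letter⋢end i (inˡ p) = left-pair⋢unary 1 p
letter⋢end i (inʳ p) = left-pair⋢unary 1 p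

letter⊑letter⇒≡ : letter i ⊑ letter j → i ≡ j
letter⊑letter⇒≡ {i} {j} p = occurrence p refl
  where
  occurrence : letter i ⊑ t → t ≡ letter j → i ≡ j
  occurrence here    eq   = letter-injective eq
  occurrence (inˡ p) refl = ⊥-elim (left-pair⋢unary (suc j) p)
  occurrence (inʳ ()) refl


infixl 6 _⁀_
_⁀_ : H → H → H
t ⁀ u = t [ end ↦ u ]

code-⁀ : ∀ es fs → code es ⁀ code fs ≡ code (es ++ fs)
code-⁀ []       fs = refl
code-⁀ (i ∷ es) fs =
  trans ([↦]-pair (code∷≢end i es)) (cong₂ ⟨_,_⟩ ([↦]-fresh {s = code fs} (end⋢letter i)) (code-⁀ es fs))

rename : ℕ → ℕ → ℕ → ℕ
rename j j' i with i ≟ j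
... | yes _ = j'
... | no _  = i

letter-rename : ∀ j j' i → letter i [ letter j ↦ letter j' ] ≡ letter (rename j j' i)
letter-rename j j' i with i ≟ j
... | yes i≡j = [↦]-hit (cong letter i≡j)
... | no i≢j  = [↦]-fresh (i≢j ∘ sym ∘ letter⊑letter⇒≡)

code-rename : ∀ j j' es → code es [ letter j ↦ letter j' ] ≡ code (map (rename j j') es)
code-rename j j' []       = [↦]-fresh (letter⋢end j)
code-rename j j' (i ∷ es) =
  trans ([↦]-pair (code≢⊥ es ∘ proj₂ ∘ ⟨,⟩-injective))
        (cong₂ ⟨_,_⟩ (letter-rename j j' i) (code-rename j j' es))

collapse : ℕ → H → H
collapse zero    t = t
collapse (suc j) t = collapse j (t [ letter (suc j) ↦ letter 0 ])

rename-≤ : i ≤ suc j → rename (suc j) 0 i ≤ j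
rename-≤ {i} {j} i≤1+j with i ≟ suc j
... | yes _     = z≤n
... | no i≢1+j = m<1+n⇒m≤n (≤∧≢⇒< i≤1+j i≢1+j)

All≤0⇒zeros : All (_≤ 0) es → es ≡ replicate (length es) 0
All≤0⇒zeros []             = refl
All≤0⇒zeros (z≤n ∷ les) = cong (0 ∷_) (All≤0⇒zeros les)

collapse-code : ∀ j es → All (_≤ j) es → collapse j (code es) ≡ code (replicate (length es) 0)
collapse-code zero    es les = cong code (All≤0⇒zeros les)
collapse-code (suc j) es les = begin
  collapse j (code es [ letter (suc j) ↦ letter 0 ])  ≡⟨ cong (collapse j) (code-rename (suc j) 0 es) ⟩
  collapse j (code (map (rename (suc j) 0) es))       ≡⟨ collapse-code j _ (map⁺ (All.map rename-≤ les)) ⟩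
  code (replicate (length (map (rename (suc j) 0) es)) 0) ≡⟨ cong (λ m → code (replicate m 0)) (length-map _ es) ⟩
  code (replicate (length es) 0)                      ∎
  where open ≡-Reasoning

letter-rename-reflect : a [ letter (suc j) ↦ letter 0 ] ≡ letter i → a ≡ letter (suc j) ⊎ a ≡ letter i
letter-rename-reflect {i = zero}  eq = [↦]≡target eq
letter-rename-reflect {i = suc i} eq = inj₂ ([↦]-reflect (0≢1+n ∘ letter⊑letter⇒≡) eq)

code-rename-reflect : ∀ j t es → t [ letter (suc j) ↦ letter 0 ] ≡ code es → All (_≤ j) es →
                      ∃[ es' ] t ≡ code es' × All (_≤ suc j) es'
code-rename-reflect j t []       eq []          = [] , [↦]-reflect (letter⋢end 0) eq , []
code-rename-reflect j t (i ∷ es) eq (i≤j ∷ les) with t ≟ₕ letter (suc j)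
... | yes refl = ⊥-elim (code≢⊥ es (sym (proj₂ (⟨,⟩-injective eq))))
code-rename-reflect j ⊥ₕ        (i ∷ es) ()  _           | no _
code-rename-reflect j ⟨ a , b ⟩ (i ∷ es) eq (i≤j ∷ les) | no _ with ⟨,⟩-injective eq
... | eqᵃ , eqᵇ with code-rename-reflect j b es eqᵇ les
... | es' , refl , les' with letter-rename-reflect eqᵃ
... | inj₁ refl = suc j ∷ es' , refl , ≤-refl ∷ les'
... | inj₂ refl = i ∷ es' , refl , m≤n⇒m≤1+n i≤j ∷ les'

collapse-reflect : ∀ j t es → collapse j t ≡ code es → All (_≤ 0) es →
                   ∃[ es' ] t ≡ code es' × All (_≤ j) es'
collapse-reflect zero    t es eq les = es , eq , les
collapse-reflect (suc j) t es eq les with collapse-reflect j _ es eq les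
... | es' , eq' , les' = code-rename-reflect j t es' eq' les'

replicate-∷ʳ : ∀ m (x : ℕ) → replicate m x ++ [ x ] ≡ x ∷ replicate m x
replicate-∷ʳ zero    x = refl
replicate-∷ʳ (suc m) x = cong (x ∷_) (replicate-∷ʳ m x)

power-commutes : ∀ m → code (replicate m 0) ⁀ code [ 0 ] ≡ ⟨ letter 0 , code (replicate m 0) ⟩
power-commutes m = trans (code-⁀ (replicate m 0) [ 0 ]) (cong code (replicate-∷ʳ m 0))

-- If t = ⟨a, b⟩ then b ⁀ c₀ = ⟨a, b⟩, the same equation with s := a; by induction a = c₀.
commutes⇒power : t ⁀ code [ 0 ] ≡ ⟨ s , t ⟩ → s ≡ letter 0 × ∃[ m ] t ≡ code (replicate m 0)
commutes⇒power {t} eq with t ≟ₕ end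
... | yes refl = sym (proj₁ (⟨,⟩-injective eq)) , 0 , refl
commutes⇒power {⊥ₕ}        () | no _
commutes⇒power {⟨ a , b ⟩} eq | no _ with ⟨,⟩-injective eq
... | eqᵃ , eqᵇ with commutes⇒power eqᵇ
... | refl , m , refl = trans (sym eqᵃ) ([↦]-fresh {s = code [ 0 ]} (end⋢letter 0)) , suc m , refl

IsWord : ℕ → H → Set
IsWord j t = collapse j t ⁀ code [ 0 ] ≡ ⟨ letter 0 , collapse j t ⟩

code-IsWord : ∀ j es → All (_≤ j) es → IsWord j (code es)
code-IsWord j es les rewrite collapse-code j es les = power-commutes (length es)

IsWord⇒code : ∀ j t → IsWord j t → ∃[ es ] t ≡ code es × All (_≤ j) es
IsWord⇒code j t isWord with commutes⇒power isWord
... | _ , m , eq = collapse-reflect j t (replicate m 0) eq (replicate⁺ m z≤n)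

tallyₕ : ℕ → ℕ → H → H
tallyₕ j i t = collapse j t [ letter 0 ↦ letter i ]

code-tallyₕ : ∀ j i es → All (_≤ j) es → tallyₕ j i (code es) ≡ code (replicate (length es) i)
code-tallyₕ j i es les = begin
  collapse j (code es) [ letter 0 ↦ letter i ]           ≡⟨ cong (_[ letter 0 ↦ letter i ]) (collapse-code j es les) ⟩
  code (replicate (length es) 0) [ letter 0 ↦ letter i ] ≡⟨ code-rename 0 i (replicate (length es) 0) ⟩
  code (map (rename 0 i) (replicate (length es) 0))      ≡⟨ cong code (map-replicate (rename 0 i) (length es) 0) ⟩
  code (replicate (length es) i)                         ∎
  where open ≡-Reasoning

IsWord-⁀ : ∀ j → IsWord j t → IsWord j u → IsWord j (t ⁀ u)
IsWord-⁀ j isWordₜ isWordᵤ with IsWord⇒code j _ isWordₜ | IsWord⇒code j _ isWordᵤ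
... | es , refl , les | fs , refl , lfs rewrite code-⁀ es fs = code-IsWord j (es ++ fs) (++⁺ les lfs)

IsWord-tallyₕ : ∀ j → i ≤ j → IsWord j t → IsWord j (tallyₕ j i t)
IsWord-tallyₕ {i} j i≤j isWord with IsWord⇒code j _ isWord
... | es , refl , les rewrite code-tallyₕ j i es les =
  code-IsWord j (replicate (length es) i) (replicate⁺ (length es) i≤j)

⌜_⌝ : ∀ {m} → H → Tm m
⌜ ⊥ₕ ⌝        = bot
⌜ ⟨ a , b ⟩ ⌝ = pair ⌜ a ⌝ ⌜ b ⌝

evalTm-⌜⌝ : ∀ {m} (ρ : Vec H m) t → evalTm ρ ⌜ t ⌝ ≡ t
evalTm-⌜⌝ ρ ⊥ₕ        = refl
evalTm-⌜⌝ ρ ⟨ a , b ⟩ = cong₂ ⟨_,_⟩ (evalTm-⌜⌝ ρ a) (evalTm-⌜⌝ ρ b)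

evalTm-sub⌜⌝ : ∀ {m} (ρ : Vec H m) x r s → evalTm ρ (sub x ⌜ r ⌝ ⌜ s ⌝) ≡ evalTm ρ x [ r ↦ s ]
evalTm-sub⌜⌝ ρ x r s = cong₂ (evalTm ρ x [_↦_]) (evalTm-⌜⌝ ρ r) (evalTm-⌜⌝ ρ s)

collapseTm : ∀ {m} → ℕ → Tm m → Tm m
collapseTm zero    x = x
collapseTm (suc j) x = collapseTm j (sub x ⌜ letter (suc j) ⌝ ⌜ letter 0 ⌝)

evalTm-collapseTm : ∀ {m} (ρ : Vec H m) j x → evalTm ρ (collapseTm j x) ≡ collapse j (evalTm ρ x)
evalTm-collapseTm ρ zero    x = refl
evalTm-collapseTm ρ (suc j) x =
  trans (evalTm-collapseTm ρ j _) (cong (collapse j) (evalTm-sub⌜⌝ ρ x (letter (suc j)) (letter 0)))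

tallyTm : ∀ {m} → ℕ → ℕ → Tm m → Tm m
tallyTm j i x = sub (collapseTm j x) ⌜ letter 0 ⌝ ⌜ letter i ⌝

evalTm-tallyTm : ∀ {m} (ρ : Vec H m) j i x → evalTm ρ (tallyTm j i x) ≡ tallyₕ j i (evalTm ρ x)
evalTm-tallyTm ρ j i x =
  trans (evalTm-sub⌜⌝ ρ (collapseTm j x) (letter 0) (letter i))
        (cong (_[ letter 0 ↦ letter i ]) (evalTm-collapseTm ρ j x))

isWordFm : ∀ {m} → ℕ → Tm m → ExFm m
isWordFm j x = sub (collapseTm j x) ⌜ end ⌝ ⌜ code [ 0 ] ⌝ ≐ pair ⌜ letter 0 ⌝ (collapseTm j x)

isWordFm-sound : ∀ {m} (ρ : Vec H m) j x → Sat ρ (isWordFm j x) → IsWord j (evalTm ρ x)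
isWordFm-sound ρ j x = subst (λ c → c ⁀ code [ 0 ] ≡ ⟨ letter 0 , c ⟩) (evalTm-collapseTm ρ j x)

isWordFm-complete : ∀ {m} (ρ : Vec H m) j x → IsWord j (evalTm ρ x) → Sat ρ (isWordFm j x)
isWordFm-complete ρ j x = subst (λ c → c ⁀ code [ 0 ] ≡ ⟨ letter 0 , c ⟩) (sym (evalTm-collapseTm ρ j x))

x₀ : ∀ {m} → Tm (suc m)
x₀ = var fzero

x₁ : ∀ {m} → Tm (suc (suc m))
x₁ = var (fsuc fzero)

x₂ : ∀ {m} → Tm (suc (suc (suc m)))
x₂ = var (fsuc (fsuc fzero))

module StringInterpretation (n' : ℕ) (k : Fin (suc n')) where

  open Structure (StrStructure k) using (const; fun)

  Word : Set
  Word = List (Fin (suc n'))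

  ι : Word → H
  ι w = code (map toℕ w)

  letters≤n' : ∀ (w : Word) → All (_≤ n') (map toℕ w)
  letters≤n' w = map⁺ (All.universal toℕ≤pred[n] w)

  ι-IsWord : ∀ (w : Word) → IsWord n' (ι w)
  ι-IsWord w = code-IsWord n' (map toℕ w) (letters≤n' w)

  fromℕ≤-list : All (_≤ n') es → Σ[ w ∈ Word ] map toℕ w ≡ es
  fromℕ≤-list []            = [] , refl
  fromℕ≤-list (i≤n' ∷ les) with fromℕ≤-list les
  ... | w , refl = fromℕ< (s≤s i≤n') ∷ w , cong (_∷ map toℕ w) (toℕ-fromℕ< (s≤s i≤n'))

  IsWord⇒ι : IsWord n' t → Σ[ w ∈ Word ] ι w ≡ t
  IsWord⇒ι {t} isWord with IsWord⇒code n' t isWord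
  ... | es , refl , les with fromℕ≤-list les
  ... | w , refl = w , refl

  ι-injective : ∀ (w v : Word) → ι w ≡ ι v → w ≡ v
  ι-injective w v = map-injective toℕ-injective ∘ code-injective (map toℕ w) (map toℕ v)

  ι-++ : ∀ (w v : Word) → ι w ⁀ ι v ≡ ι (w ++ v)
  ι-++ w v = trans (code-⁀ (map toℕ w) (map toℕ v)) (cong code (sym (map-++ toℕ w v)))

  ι-tallyLen : ∀ (w : Word) → tallyₕ n' (toℕ k) (ι w) ≡ ι (tallyLen k w)
  ι-tallyLen w = begin
    tallyₕ n' (toℕ k) (ι w)                          ≡⟨ code-tallyₕ n' (toℕ k) (map toℕ w) (letters≤n' w) ⟩
    code (replicate (length (map toℕ w)) (toℕ k))    ≡⟨ cong (λ m → code (replicate m (toℕ k))) (length-map toℕ w) ⟩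
    code (replicate (length w) (toℕ k))              ≡⟨ cong code (map-replicate toℕ (length w) k) ⟨
    ι (tallyLen k w)                                 ∎
    where open ≡-Reasoning

  δ : ExFm 1
  δ = isWordFm n' x₀

  φ-fun : ∀ {m} → StrFun m → ExFm (suc m)
  φ-fun concat = (x₀ ≐ sub x₁ ⌜ end ⌝ x₂) ∧ (isWordFm n' x₀ ∧ (isWordFm n' x₁ ∧ isWordFm n' x₂))
  φ-fun tally  = (x₀ ≐ tallyTm n' (toℕ k) x₁) ∧ (isWordFm n' x₀ ∧ isWordFm n' x₁)

  InA' : H → Set
  InA' h = Sat (h ∷ []) δ

  IsWord⇒InA' : ∀ {h} → IsWord n' h → InA' h
  IsWord⇒InA' {h} = isWordFm-complete (h ∷ []) n' x₀

  InA'⇒IsWord : ∀ {h} → InA' h → IsWord n' h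
  InA'⇒IsWord {h} = isWordFm-sound (h ∷ []) n' x₀

  isWordFm⇒InA' : ∀ {m} (ρ : Vec H m) x → Sat ρ (isWordFm n' x) → InA' (evalTm ρ x)
  isWordFm⇒InA' ρ x = IsWord⇒InA' ∘ isWordFm-sound ρ n' x

  interpretation : ∃-Interpretable (StrStructure k)
  interpretation = record
    { δ         = δ
    ; φc        = λ c → x₀ ≐ ⌜ ι (const c) ⌝
    ; φf        = φ-fun
    ; φR        = λ ()
    ; φRᶜ       = λ ()
    ; nonempty  = ι [] , IsWord⇒InA' (ι-IsWord [])
    ; const-def = λ c → ι (const c) , IsWord⇒InA' (ι-IsWord (const c)) ,
                        sym (evalTm-⌜⌝ _ (ι (const c))) , λ h eq → trans eq (evalTm-⌜⌝ _ _)
    ; fun-dom   = fun-dom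
    ; fun-total = fun-total
    ; fun-func  = fun-func
    ; rel-dom   = λ ()
    ; rel-cover = λ ()
    ; rel-disj  = λ ()
    ; ι         = ι
    ; ι-inj     = ι-injective
    ; ι-into    = IsWord⇒InA' ∘ ι-IsWord
    ; ι-onto    = λ h → IsWord⇒ι ∘ InA'⇒IsWord
    ; ι-const   = λ c → sym (evalTm-⌜⌝ _ (ι (const c)))
    ; ι-fun     = ι-fun
    ; ι-rel     = λ ()
    }
    where
    fun-dom : ∀ {m} (f : StrFun m) xs y → Sat (y ∷ xs) (φ-fun f) → AllVec.All InA' xs × InA' y
    fun-dom concat (u ∷ v ∷ []) y (_ , isWordʸ , isWordᵘ , isWordᵛ) =
      (isWordFm⇒InA' _ x₁ isWordᵘ ∷ isWordFm⇒InA' _ x₂ isWordᵛ ∷ []) , isWordFm⇒InA' _ x₀ isWordʸ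
    fun-dom tally (u ∷ []) y (_ , isWordʸ , isWordᵘ) =
      (isWordFm⇒InA' _ x₁ isWordᵘ ∷ []) , isWordFm⇒InA' _ x₀ isWordʸ

    fun-total : ∀ {m} (f : StrFun m) xs → AllVec.All InA' xs → ∃[ y ] Sat (y ∷ xs) (φ-fun f)
    fun-total concat (u ∷ v ∷ []) (inᵘ ∷ inᵛ ∷ []) =
      u ⁀ v , refl ,
      isWordFm-complete _ n' x₀ (IsWord-⁀ n' (InA'⇒IsWord inᵘ) (InA'⇒IsWord inᵛ)) ,
      isWordFm-complete _ n' x₁ (InA'⇒IsWord inᵘ) , isWordFm-complete _ n' x₂ (InA'⇒IsWord inᵛ)
    fun-total tally (u ∷ []) (inᵘ ∷ []) =
      tallyₕ n' (toℕ k) u , sym (evalTm-tallyTm _ n' (toℕ k) x₁) ,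
      isWordFm-complete _ n' x₀ (IsWord-tallyₕ n' (toℕ≤pred[n] k) (InA'⇒IsWord inᵘ)) ,
      isWordFm-complete _ n' x₁ (InA'⇒IsWord inᵘ)

    fun-func : ∀ {m} (f : StrFun m) xs y y' → Sat (y ∷ xs) (φ-fun f) → Sat (y' ∷ xs) (φ-fun f) → y ≡ y'
    fun-func concat (u ∷ v ∷ []) y y' (eq , _) (eq' , _) = trans eq (sym eq')
    fun-func tally  (u ∷ [])     y y' (eq , _) (eq' , _) =
      trans (trans eq (evalTm-tallyTm (y ∷ u ∷ []) n' (toℕ k) x₁))
            (sym (trans eq' (evalTm-tallyTm (y' ∷ u ∷ []) n' (toℕ k) x₁)))

    ι-fun : ∀ {m} (f : StrFun m) ws → Sat (ι (fun f ws) ∷ Vec.map ι ws) (φ-fun f)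
    ι-fun concat (w ∷ v ∷ []) =
      sym (ι-++ w v) , isWordFm-complete _ n' x₀ (ι-IsWord (w ++ v)) ,
      isWordFm-complete _ n' x₁ (ι-IsWord w) , isWordFm-complete _ n' x₂ (ι-IsWord v)
    ι-fun tally (w ∷ []) =
      trans (sym (ι-tallyLen w)) (sym (evalTm-tallyTm _ n' (toℕ k) x₁)) ,
      isWordFm-complete _ n' x₀ (ι-IsWord (tallyLen k w)) , isWordFm-complete _ n' x₁ (ι-IsWord w)

theorem4 : (n : ℕ) (k : Fin n) → ∃-Interpretable (StrStructure {n} k)
theorem4 zero    ()
theorem4 (suc n') k = StringInterpretation.interpretation n' k
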